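{- Let $k\ge 2$, $n\ge1$, let $f:(\{0,1\}^n)^k\to\{0,1\}$ be an arbitrary $k$-argument boolean function, and let $\ell$ be a positive integer divisible by $k-1$. Then $D^{\mathrm{NOF}}(f^{\ell})\le \ell\cdot\frac{n}{k-1}+\ell$.
   Context: Number-on-the-forehead (NOF) model: $k$ parties $P_1,\dots,P_k$; each input argument $x_j\in\{0,1\}^n$ is seen by every party except $P_j$. Parties communicate by writing bits on a shared board visible to all; at the end all parties must know the output. $D^{\mathrm{NOF}}(g)$ is the deterministic NOF communication complexity of $g$: the minimum, over deterministic NOF protocols computing $g$, of the worst-case number of bits written on the board. $f^{\ell}$ denotes computing $f$ on $\ell$ independent instances: the input consists of $x_{i,j}\in\{0,1\}^n$ ($i\in[\ell]$, $j\in[k]$), with $x_{i,j}$ the $j$-th argument of instance $i$, on $P_j$'s forehead; all parties must learn $f$'s value on every instance. -}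

module Defs where

open import Data.Bool using (Bool)
open import Data.Nat using (ℕ; zero; suc; _⊔_)
open import Data.Fin using (Fin)
open import Data.Vec using (Vec; lookup; map; tabulate)
open import Relation.Binary.PropositionalEquality using (_≡_; _≢_)

-- A k-argument input: argument j (a value in A) sits on the forehead of party j.

SeesOnly : {k : ℕ} {A : Set} → Fin k → (Vec A k → Bool) → Set
SeesOnly {k} j s = ∀ x y → (∀ j′ → j′ ≢ j → lookup x j′ ≡ lookup y j′) → s x ≡ s y

-- Deterministic NOF protocol trees (Kushilevitz–Nisan style): at an internal node
-- party j writes a bit on the board, computed from what j sees (the transcript so
-- far is encoded by the position in the tree); the output is a function of the
-- board, i.e. a label at the leaf (so every party knows it).
data NOFProtocol (k : ℕ) (A : Set) (O : Set) : Set where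
  leaf : O → NOFProtocol k A O
  node : (j : Fin k) (s : Vec A k → Bool) → SeesOnly j s →
         (on0 on1 : NOFProtocol k A O) → NOFProtocol k A O

run : {k : ℕ} {A O : Set} → NOFProtocol k A O → Vec A k → O
run (leaf o) x = o
run (node j s _ p q) x with s x
... | Bool.false = run p x
... | Bool.true  = run q x

cost : {k : ℕ} {A O : Set} → NOFProtocol k A O → ℕ
cost (leaf _) = 0
cost (node _ _ _ p q) = suc (cost p ⊔ cost q)

Computes : {k : ℕ} {A O : Set} → NOFProtocol k A O → (Vec A k → O) → Set
Computes P g = ∀ x → run P x ≡ g x

DNOF≤ : {k : ℕ} {A O : Set} → (Vec A k → O) → ℕ → Set
DNOF≤ {k} {A} {O} g c = Data.Product.Σ (NOFProtocol k A O) (λ P → Computes P g Data.Product.× cost P Data.Nat.≤ c)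
  where import Data.Product; import Data.Nat

Bits : ℕ → Set
Bits n = Vec Bool n

-- f^ℓ: argument j of f^ℓ is the vector (x_{1,j},…,x_{ℓ,j}) on P_j's forehead;
-- the output is the vector of values of f on the ℓ instances.
power : {k n : ℕ} → (Vec (Bits n) k → Bool) → (ℓ : ℕ) →
        Vec (Vec (Bits n) ℓ) k → Vec Bool ℓ
power f ℓ x = tabulate (λ i → f (map (λ xj → lookup xj i) x))

module Submission where

-- Split the ℓ = q(k−1) instances into q blocks of k−1. The r-th instance of a block is
-- answered by party r, who sees all its arguments except the r-th one; call that one the
-- block's r-th diagonal argument. The last party sees every diagonal argument and writes
-- their bitwise xor (n bits per block); party r recovers its missing diagonal argument by
-- xoring this with the diagonal arguments it does see, and writes f of its instance.
-- In total q·n + ℓ = ℓ·n/(k−1) + ℓ bits.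

open import Defs
open import Data.Bool using (Bool)
open import Data.Nat using (ℕ; _+_; _*_; _∸_; _≤_)
open import Data.Nat.Divisibility using (_∣_)
open import Data.Vec using (Vec)
open import Data.Product using (Σ; _×_)

open import Algebra.Bundles using (CommutativeRing)
open import Data.Bool using (true; false; _xor_)
open import Data.Bool.Properties using (xor-∧-commutativeRing; xor-identityʳ)
open import Data.Fin using (Fin; zero; suc; inject₁; fromℕ; combine; quotient; remainder; punchIn; _≟_)
open import Data.Fin.Properties using (fromℕ≢inject₁; inject₁-injective; punchInᵢ≢i; combine-remQuot; remQuot-combine)
open import Data.Nat using (zero; suc; z≤n; s≤s)
open import Data.Nat.Divisibility using (divides)
open import Data.Nat.Properties using (⊔-lub; +-identityʳ; ≤-reflexive)
open import Data.Nat.Solver using (module +-*-Solver)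
open import Data.Product using (_,_; proj₁; proj₂)
open import Data.Vec using ([]; _∷_; lookup; map; replicate; tabulate; _[_]≔_)
open import Data.Vec.Functional using (removeAt)
open import Data.Vec.Properties
  using (tabulate∘lookup; tabulate-cong; lookup∘tabulate; lookup-replicate; lookup∘update; lookup∘update′;
         map-[]≔; []≔-idempotent; []≔-lookup; lookup-map)
open import Function using (_∘_)
open import Relation.Binary.PropositionalEquality
open import Relation.Nullary using (yes; no)

open import Algebra.Properties.CommutativeMonoid.Sum
  (CommutativeRing.+-commutativeMonoid xor-∧-commutativeRing)
  using (sum-remove; sum-cong-≗) renaming (sum to xor-sum)

open ≡-Reasoning

lookup-extensionality : {A : Set} {n : ℕ} (xs ys : Vec A n) → lookup xs ≗ lookup ys → xs ≡ ys
lookup-extensionality xs ys eq = begin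
  xs                     ≡⟨ tabulate∘lookup xs ⟨
  tabulate (lookup xs)   ≡⟨ tabulate-cong eq ⟩
  tabulate (lookup ys)   ≡⟨ tabulate∘lookup ys ⟩
  ys                     ∎

[]≔-map-[]≔-lookup : {A B : Set} {n : ℕ} (h : A → B) (xs : Vec A n) (j : Fin n) (a : A) →
                     map h (xs [ j ]≔ a) [ j ]≔ h (lookup xs j) ≡ map h xs
[]≔-map-[]≔-lookup h xs j a = begin
  map h (xs [ j ]≔ a) [ j ]≔ h (lookup xs j)        ≡⟨ cong (_[ j ]≔ h (lookup xs j)) (map-[]≔ h xs j) ⟩
  (map h xs [ j ]≔ h a) [ j ]≔ h (lookup xs j)      ≡⟨ []≔-idempotent (map h xs) j ⟩
  map h xs [ j ]≔ h (lookup xs j)                   ≡⟨ cong (map h xs [ j ]≔_) (lookup-map j h xs) ⟨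
  map h xs [ j ]≔ lookup (map h xs) j               ≡⟨ []≔-lookup (map h xs) j ⟩
  map h xs                                          ∎

xor-cancel-common : ∀ a b c → (a xor c) xor (b xor c) ≡ a xor b
xor-cancel-common false false false = refl
xor-cancel-common false false true  = refl
xor-cancel-common false true  false = refl
xor-cancel-common false true  true  = refl
xor-cancel-common true  false false = refl
xor-cancel-common true  false true  = refl
xor-cancel-common true  true  false = refl
xor-cancel-common true  true  true  = refl

xor-sum-differ-at : {n : ℕ} (u v : Fin n → Bool) (r : Fin n) → (∀ s → s ≢ r → u s ≡ v s) →
                    xor-sum u xor xor-sum v ≡ u r xor v r
xor-sum-differ-at {suc n} u v r agree = begin
  xor-sum u xor xor-sum v                                   ≡⟨ cong₂ _xor_ (sum-remove {i = r} u) (sum-remove {i = r} v) ⟩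
  (u r xor xor-sum u′) xor (v r xor xor-sum (removeAt v r))  ≡⟨ cong (λ s → (u r xor xor-sum u′) xor (v r xor s)) same-rest ⟩
  (u r xor xor-sum u′) xor (v r xor xor-sum u′)              ≡⟨ xor-cancel-common (u r) (v r) (xor-sum u′) ⟩
  u r xor v r                                               ∎
  where
  u′ : Fin n → Bool
  u′ = removeAt u r
  same-rest : xor-sum (removeAt v r) ≡ xor-sum u′
  same-rest = sum-cong-≗ (λ s → sym (agree (punchIn r s) (punchInᵢ≢i r s)))

module NOFWriting {k : ℕ} {A O : Set} (blank : A) where

  -- Party j can compute exactly the functions of its view `hide j x`.
  hide : Fin k → Vec A k → Vec A k
  hide j x = x [ j ]≔ blank

  hide-sees : (j : Fin k) (t : Vec A k → Bool) → SeesOnly j (t ∘ hide j)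
  hide-sees j t x y agree = cong t (lookup-extensionality _ _ same)
    where
    same : lookup (hide j x) ≗ lookup (hide j y)
    same j′ with j′ ≟ j
    ... | yes refl = trans (lookup∘update j x blank) (sym (lookup∘update j y blank))
    ... | no j′≢j  = begin
      lookup (hide j x) j′  ≡⟨ lookup∘update′ j′≢j x blank ⟩
      lookup x j′           ≡⟨ agree j′ j′≢j ⟩
      lookup y j′           ≡⟨ lookup∘update′ j′≢j y blank ⟨
      lookup (hide j y) j′  ∎

  writeBits : (m : ℕ) (writer : Fin m → Fin k) (msg : Fin m → Vec A k → Bool) →
              (Bits m → NOFProtocol k A O) → NOFProtocol k A O
  writeBits zero    writer msg next = next []
  writeBits (suc m) writer msg next =
    node (writer zero) (msg zero ∘ hide (writer zero)) (hide-sees (writer zero) (msg zero))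
      (writeBits m (writer ∘ suc) (msg ∘ suc) (next ∘ (false ∷_)))
      (writeBits m (writer ∘ suc) (msg ∘ suc) (next ∘ (true ∷_)))

  run-writeBits : ∀ m writer msg next (x : Vec A k) →
                  run (writeBits m writer msg next) x ≡
                  run (next (tabulate (λ i → msg i (hide (writer i) x)))) x
  run-writeBits zero    writer msg next x = refl
  run-writeBits (suc m) writer msg next x with msg zero (hide (writer zero) x)
  ... | false = run-writeBits m (writer ∘ suc) (msg ∘ suc) (next ∘ (false ∷_)) x
  ... | true  = run-writeBits m (writer ∘ suc) (msg ∘ suc) (next ∘ (true ∷_)) x

  cost-writeBits : ∀ m writer msg next (c : ℕ) → (∀ y → cost (next y) ≤ c) →
                   cost (writeBits m writer msg next) ≤ m + c
  cost-writeBits zero    writer msg next c bound = bound []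
  cost-writeBits (suc m) writer msg next c bound =
    s≤s (⊔-lub (cost-writeBits m (writer ∘ suc) (msg ∘ suc) _ c (bound ∘ (false ∷_)))
               (cost-writeBits m (writer ∘ suc) (msg ∘ suc) _ c (bound ∘ (true ∷_))))

module PowerProtocol {K n q : ℕ} (f : Vec (Bits n) (suc K) → Bool) where

  Input : Set
  Input = Vec (Vec (Bits n) (q * K)) (suc K)

  blank : Vec (Bits n) (q * K)
  blank = replicate _ (replicate _ false)

  open NOFWriting {suc K} {Vec (Bits n) (q * K)} {Vec Bool (q * K)} blank

  writer : Fin (suc K)
  writer = fromℕ K

  answerer : Fin (q * K) → Fin (suc K)
  answerer i = inject₁ (remainder {q} K i)

  -- Instance `combine g r` is the r-th instance of block g.
  diagonalBit : Input → Fin q → Fin n → Fin K → Bool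
  diagonalBit x g b r = lookup (lookup (lookup x (inject₁ r)) (combine g r)) b

  parity : Input → Fin q → Fin n → Bool
  parity x g b = xor-sum (diagonalBit x g b)

  parityMsg : Fin (q * n) → Input → Bool
  parityMsg i x = parity x (quotient n i) (remainder {q} n i)

  instanceArgs : Fin (q * K) → Input → Vec (Bits n) (suc K)
  instanceArgs i x = map (λ a → lookup a i) x

  recover : Bits (q * n) → Input → Fin q → Bits n
  recover board x g = tabulate (λ b → lookup board (combine g b) xor parity x g b)

  answerMsg : Bits (q * n) → Fin (q * K) → Input → Bool
  answerMsg board i x = f (instanceArgs i x [ answerer i ]≔ recover board x (quotient K i))

  protocol : NOFProtocol (suc K) (Vec (Bits n) (q * K)) (Vec Bool (q * K))
  protocol = writeBits (q * n) (λ _ → writer) parityMsg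
               (λ board → writeBits (q * K) answerer (answerMsg board) leaf)

  cost-protocol : cost protocol ≤ q * n + q * K
  cost-protocol = subst (cost protocol ≤_) (cong (q * n +_) (+-identityʳ (q * K)))
    (cost-writeBits (q * n) _ parityMsg _ (q * K + 0)
      (λ board → cost-writeBits (q * K) answerer (answerMsg board) leaf 0 (λ _ → z≤n)))

  board : Input → Bits (q * n)
  board x = tabulate (λ i → parityMsg i (hide writer x))

  parity-hide-writer : ∀ x g b → parity (hide writer x) g b ≡ parity x g b
  parity-hide-writer x g b = sum-cong-≗ λ r →
    cong (λ a → lookup (lookup a (combine g r)) b) (lookup∘update′ (fromℕ≢inject₁ ∘ sym) x blank)

  lookup-board : ∀ x g b → lookup (board x) (combine g b) ≡ parity x g b
  lookup-board x g b = begin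
    lookup (board x) (combine g b)                                  ≡⟨ lookup∘tabulate _ (combine g b) ⟩
    parity (hide writer x) (quotient n (combine g b)) (remainder {q} n (combine g b))
                                                                    ≡⟨ cong₂ (parity (hide writer x)) quotient≡ remainder≡ ⟩
    parity (hide writer x) g b                                      ≡⟨ parity-hide-writer x g b ⟩
    parity x g b                                                    ∎
    where
    quotient≡ : quotient n (combine g b) ≡ g
    quotient≡ = cong proj₁ (remQuot-combine g b)
    remainder≡ : remainder {q} n (combine g b) ≡ b
    remainder≡ = cong proj₂ (remQuot-combine g b)

  diagonalBit-hidden : ∀ x g b r → diagonalBit (hide (inject₁ r) x) g b r ≡ false
  diagonalBit-hidden x g b r = begin
    lookup (lookup (lookup (hide (inject₁ r) x) (inject₁ r)) (combine g r)) b
      ≡⟨ cong (λ a → lookup (lookup a (combine g r)) b) (lookup∘update (inject₁ r) x blank) ⟩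
    lookup (lookup blank (combine g r)) b
      ≡⟨ cong (λ a → lookup a b) (lookup-replicate (combine g r) _) ⟩
    lookup (replicate n false) b
      ≡⟨ lookup-replicate b false ⟩
    false ∎

  parity-hide : ∀ x g b r → parity x g b xor parity (hide (inject₁ r) x) g b ≡ diagonalBit x g b r
  parity-hide x g b r = begin
    parity x g b xor parity (hide (inject₁ r) x) g b        ≡⟨ xor-sum-differ-at _ _ r unchanged ⟩
    diagonalBit x g b r xor diagonalBit (hide (inject₁ r) x) g b r
                                                            ≡⟨ cong (diagonalBit x g b r xor_) (diagonalBit-hidden x g b r) ⟩
    diagonalBit x g b r xor false                           ≡⟨ xor-identityʳ _ ⟩
    diagonalBit x g b r                                     ∎
    where
    unchanged : ∀ s → s ≢ r → diagonalBit x g b s ≡ diagonalBit (hide (inject₁ r) x) g b s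
    unchanged s s≢r = cong (λ a → lookup (lookup a (combine g s)) b)
      (sym (lookup∘update′ (s≢r ∘ inject₁-injective) x blank))

  recover-hidden : ∀ x g r → recover (board x) (hide (inject₁ r) x) g ≡ lookup (lookup x (inject₁ r)) (combine g r)
  recover-hidden x g r = trans (tabulate-cong bit≡) (tabulate∘lookup _)
    where
    bit≡ : ∀ b → lookup (board x) (combine g b) xor parity (hide (inject₁ r) x) g b ≡ diagonalBit x g b r
    bit≡ b = trans (cong (_xor parity (hide (inject₁ r) x) g b) (lookup-board x g b)) (parity-hide x g b r)

  answerMsg-correct : ∀ x i → answerMsg (board x) i (hide (answerer i) x) ≡ f (instanceArgs i x)
  answerMsg-correct x i = cong f (begin
    instanceArgs i (hide j x) [ j ]≔ recover (board x) (hide j x) g  ≡⟨ cong (instanceArgs i (hide j x) [ j ]≔_) recovered ⟩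
    instanceArgs i (hide j x) [ j ]≔ lookup (lookup x j) i           ≡⟨ []≔-map-[]≔-lookup (λ a → lookup a i) x j blank ⟩
    instanceArgs i x                                                 ∎)
    where
    g = quotient K i
    j = answerer i
    recovered : recover (board x) (hide j x) g ≡ lookup (lookup x j) i
    recovered = trans (recover-hidden x g (remainder {q} K i)) (cong (lookup (lookup x j)) (combine-remQuot {q} K i))

  protocol-computes : Computes protocol (power f (q * K))
  protocol-computes x = begin
    run protocol x                                                     ≡⟨ run-writeBits (q * n) _ parityMsg _ x ⟩
    run (writeBits (q * K) answerer (answerMsg (board x)) leaf) x     ≡⟨ run-writeBits (q * K) answerer _ leaf x ⟩
    tabulate (λ i → answerMsg (board x) i (hide (answerer i) x))      ≡⟨ tabulate-cong (answerMsg-correct x) ⟩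
    power f (q * K) x                                                  ∎

corollary1 : (k n ℓ : ℕ) → 2 ≤ k → 1 ≤ n → 1 ≤ ℓ → (k ∸ 1) ∣ ℓ →
    (f : Vec (Bits n) k → Bool) →
    Σ ℕ (λ c → DNOF≤ (power f ℓ) c × c * (k ∸ 1) ≤ ℓ * n + ℓ * (k ∸ 1))
corollary1 (suc (suc K)) n .(q * suc K) (s≤s (s≤s z≤n)) _ _ (divides q refl) f =
  q * n + q * suc K , (protocol , protocol-computes , cost-protocol) , ≤-reflexive scaled
  where
  open PowerProtocol {suc K} {n} {q} f
  open +-*-Solver
  scaled : (q * n + q * suc K) * suc K ≡ q * suc K * n + q * suc K * suc K
  scaled = solve 3 (λ q n k → (q :* n :+ q :* k) :* k := q :* k :* n :+ q :* k :* k) refl q n (suc K)
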